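{- For every integer $l \geq 4$, $\sigma^{ - }(P(2l,2)) = 6$.
   Context: For $n \geq 3$, $k \geq 1$ with $2k<n$, the generalized Petersen graph $P(n,k)$ has vertex set $\{u_i, v_i : i=0,1,\dots,n-1\}$ and edge set $\{u_iu_{i+1},\ u_iv_i,\ v_iv_{i+k} : i=0,\dots,n-1\}$, subscripts read modulo $n$. For a simple connected graph $G$ of order $N$, the \textbf{rna} number $\sigma^{ - }(G)$ is the minimum, over all bijections $f: V(G)\to\{1,2,\dots,N\}$, of the number of edges $uv$ of $G$ such that $f(u)$ and $f(v)$ have different parity. -}

module Defs where

open import Data.Nat using (ℕ; zero; suc; _+_; _*_; _%_; NonZero)
open import Data.Nat.DivMod using (_mod_)
open import Data.Fin using (Fin; toℕ)
open import Data.Bool using (Bool; true; false; if_then_else_; _xor_)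
open import Data.Nat using (_≡ᵇ_)
open import Data.Nat.ListAction using (sum)
open import Data.List using (List; []; _∷_; map; allFin; concatMap)
open import Data.Product using (_×_; _,_; ∃; Σ)
open import Function.Bundles using (_⤖_; Bijection)
open import Relation.Binary.PropositionalEquality using (_≡_)

data Vtx (n : ℕ) : Set where
  u : Fin n → Vtx n
  v : Fin n → Vtx n

-- i + j read modulo n
-- (Fin n is empty for n = 0, so the modulus is always nonzero here.)
_⊕_ : ∀ {n} → Fin n → ℕ → Fin n
_⊕_ {suc n} i j = (toℕ i + j) mod (suc n)

-- The edges of P(n,k), listed as ordered pairs of endpoints:
-- u_i u_{i+1}, u_i v_i, v_i v_{i+k} for i = 0..n-1.
-- For n ≥ 3, k ≥ 1, 2k < n these 3n edges are pairwise distinct,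
-- so this list is exactly the edge set.
petersenEdges : (n k : ℕ) → List (Vtx n × Vtx n)
petersenEdges n k = concatMap (λ i →
    (u i , u (i ⊕ 1)) ∷ (u i , v i) ∷ (v i , v (i ⊕ k)) ∷ []) (allFin n)

-- A labeling is a bijection f : V → {1,…,N}; we represent the label set
-- {1,…,N} as Fin N, where the element x stands for the label toℕ x + 1.
label : ∀ {N} → Fin N → ℕ
label x = toℕ x + 1

parity : ℕ → ℕ
parity m = m % 2

oddEdge : ∀ {n} → (Vtx n → Fin (2 * n)) → Vtx n × Vtx n → ℕ
oddEdge f (x , y) = if parity (label (f x)) ≡ᵇ parity (label (f y)) then 0 else 1

oddCount : (n k : ℕ) → (Vtx n ⤖ Fin (2 * n)) → ℕ
oddCount n k f = sum (map (oddEdge (Bijection.to f)) (petersenEdges n k))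

RnaNumber : (n k : ℕ) → ℕ → Set
RnaNumber n k m =
  (Σ (Vtx n ⤖ Fin (2 * n)) λ f → oddCount n k f ≡ m) ×
  ((f : Vtx n ⤖ Fin (2 * n)) → m Data.Nat.≤ oddCount n k f)

-- Colour every vertex by the parity of its label: a bijective labelling makes exactly half of
-- the 4l vertices odd, and σ⁻ counts the edges whose ends have different colours, namely X on
-- the outer cycle, S spokes, and E + O on the two inner l-cycles (through the v_i with i even,
-- resp. odd). A cycle that is not monochromatic changes colour at least twice, and S is even
-- because there are 2l odd vertices. If the outer cycle is monochromatic, balance makes all
-- 2l ≥ 8 spokes odd. Otherwise X ≥ 2, and either both inner cycles vary, or exactly one does
-- and S ≥ 2 (for S = 0 the outer cycle copies the inner colouring, and balance then forces the
-- other inner cycle to be monochromatic as well), or both are monochromatic: of one colour,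
-- balance again makes every spoke odd; of different colours, each path v_i u_i u_{i+1} v_{i+1}
-- contains an odd edge, so 2l ≤ X + 2S and hence X + S ≥ 6.
-- Conversely, odd labels on exactly the u_i and v_i with i < l give X, E, O ≤ 2 and S = 0.

module Submission where

open import Data.Bool using (Bool; true; false; not; _∧_; _xor_; if_then_else_)
import Data.Bool as Bool
open import Data.Bool.Properties using (xor-same; not-¬)
open import Data.Fin using (Fin; toℕ; combine; remQuot; cast; _↑ˡ_; _↑ʳ_) renaming (suc to fsuc)
open import Data.Fin.Patterns using (0F; 1F)
open import Data.Fin.Permutation using (Permutation′; _⟨$⟩ʳ_)
open import Data.Fin.Properties
  using (toℕ-↑ˡ; toℕ-↑ʳ; toℕ-fromℕ<; toℕ-injective; toℕ<n; toℕ-cast; cast-involutive;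
         *↔×; remQuot-combine; combine-remQuot; toℕ-combine)
open import Data.List using (List; []; _∷_; _++_; map; tabulate; concatMap; allFin)
open import Data.List.Properties using (map-++; map-tabulate)
open import Data.Nat using (ℕ; zero; suc; _+_; _*_; _∸_; _≤_; _<_; z≤n; s≤s; s≤s⁻¹; _%_; _≡ᵇ_; NonZero)
open import Data.Nat.DivMod using (_mod_; m%n<n; [m+kn]%n≡m%n; [m+n]%n≡m%n; m<n⇒m%n≡m)
open import Data.Nat.Divisibility using (_∣_; divides; _∣0; m∣m*n; ∣m∣n⇒∣m+n; ∣m+n∣m⇒∣n)
open import Data.Nat.ListAction using (sum)
open import Data.Nat.ListAction.Properties using (sum-++)
open import Data.Nat.Properties
open import Data.Product using (∃; _×_; _,_; proj₁; proj₂; uncurry; swap)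
open import Data.Product.Algebra using (×-comm)
open import Data.Product.Function.NonDependent.Propositional using (_×-↔_)
open import Data.Sum using (_⊎_; inj₁; inj₂)
open import Function using (_∘_; id)
open import Function.Bundles using (_⤖_; _↔_; Bijection; Inverse; mk↔ₛ′)
open import Function.Construct.Composition using (_↔-∘_)
open import Function.Construct.Identity using (↔-id)
open import Function.Properties.Bijection using (⤖⇒↔)
open import Function.Properties.Inverse using (↔-sym; ↔⇒⤖)
open import Relation.Binary.PropositionalEquality
open import Relation.Nullary using (yes; no; ¬?; contradiction)
open import Relation.Nullary.Decidable using (decidable-stable)

open import Defs

import Algebra.Properties.CommutativeMonoid.Sum +-0-commutativeMonoid as Finite
open import Algebra.Properties.CommutativeSemigroup +-commutativeSemigroup using (interchange)

bit : Bool → ℕ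
bit false = 0
bit true  = 1

δ : Bool → Bool → ℕ
δ a b = bit (a xor b)

bit≤1 : ∀ a → bit a ≤ 1
bit≤1 false = z≤n
bit≤1 true  = s≤s z≤n

bit≡0⇒false : ∀ {a} → bit a ≡ 0 → a ≡ false
bit≡0⇒false {false} _ = refl

bit-not+bit : ∀ a → bit (not a) + bit a ≡ 1
bit-not+bit false = refl
bit-not+bit true  = refl

δ-sym : ∀ a b → δ a b ≡ δ b a
δ-sym false false = refl
δ-sym false true  = refl
δ-sym true  false = refl
δ-sym true  true  = refl

δ-triangle : ∀ a b c → δ a c ≤ δ a b + δ b c
δ-triangle false false false = z≤n
δ-triangle false false true  = s≤s z≤n
δ-triangle false true  false = z≤n
δ-triangle false true  true  = s≤s z≤n
δ-triangle true  false false = s≤s z≤n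
δ-triangle true  false true  = z≤n
δ-triangle true  true  false = s≤s z≤n
δ-triangle true  true  true  = z≤n

≢⇒δ≡1 : ∀ {a b} → a ≢ b → δ a b ≡ 1
≢⇒δ≡1 {false} {false} a≢b = contradiction refl a≢b
≢⇒δ≡1 {false} {true}  _ = refl
≢⇒δ≡1 {true}  {false} _ = refl
≢⇒δ≡1 {true}  {true}  a≢b = contradiction refl a≢b

δ≡0⇒≡ : ∀ {a b} → δ a b ≡ 0 → a ≡ b
δ≡0⇒≡ {false} {false} _ = refl
δ≡0⇒≡ {true}  {true}  _ = refl

δ+2bit∧≡bit+bit : ∀ a b → δ a b + 2 * bit (a ∧ b) ≡ bit a + bit b
δ+2bit∧≡bit+bit false false = refl
δ+2bit∧≡bit+bit false true  = refl
δ+2bit∧≡bit+bit true  false = refl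
δ+2bit∧≡bit+bit true  true  = refl

δ+bit≡bit : ∀ {a b} → (b ≡ true → a ≡ true) → δ a b + bit b ≡ bit a
δ+bit≡bit {false} {false} _   = refl
δ+bit≡bit {false} {true}  b⇒a = contradiction (b⇒a refl) λ ()
δ+bit≡bit {true}  {false} _   = refl
δ+bit≡bit {true}  {true}  _   = refl


∑ : (ℕ → ℕ) → ℕ → ℕ
∑ f zero    = 0
∑ f (suc m) = ∑ f m + f m

module _ {f g : ℕ → ℕ} where

  ∑-cong : ∀ m → (∀ i → i < m → f i ≡ g i) → ∑ f m ≡ ∑ g m
  ∑-cong zero    _  = refl
  ∑-cong (suc m) eq = cong₂ _+_ (∑-cong m (λ i i<m → eq i (m<n⇒m<1+n i<m))) (eq m (n<1+n m))

  ∑-mono-≤ : ∀ m → (∀ i → i < m → f i ≤ g i) → ∑ f m ≤ ∑ g m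
  ∑-mono-≤ zero    _  = z≤n
  ∑-mono-≤ (suc m) le = +-mono-≤ (∑-mono-≤ m (λ i i<m → le i (m<n⇒m<1+n i<m))) (le m (n<1+n m))

  ∑-distrib-+ : ∀ m → ∑ (λ i → f i + g i) m ≡ ∑ f m + ∑ g m
  ∑-distrib-+ zero    = refl
  ∑-distrib-+ (suc m) = trans (cong (_+ (f m + g m)) (∑-distrib-+ m)) (interchange (∑ f m) (∑ g m) (f m) (g m))

∑-const : ∀ c m → ∑ (λ _ → c) m ≡ m * c
∑-const c zero    = refl
∑-const c (suc m) = trans (cong (_+ c) (∑-const c m)) (+-comm (m * c) c)

∑-ones : ∀ m → ∑ (λ _ → 1) m ≡ m
∑-ones m = trans (∑-const 1 m) (*-identityʳ m)

∑-split : ∀ f a b → ∑ f (a + b) ≡ ∑ f a + ∑ (λ i → f (a + i)) b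
∑-split f a zero    = trans (cong (∑ f) (+-identityʳ a)) (sym (+-identityʳ (∑ f a)))
∑-split f a (suc b) = begin
  ∑ f (a + suc b)                             ≡⟨ cong (∑ f) (+-suc a b) ⟩
  ∑ f (a + b) + f (a + b)                     ≡⟨ cong (_+ f (a + b)) (∑-split f a b) ⟩
  ∑ f a + ∑ (λ i → f (a + i)) b + f (a + b)   ≡⟨ +-assoc (∑ f a) _ _ ⟩
  ∑ f a + ∑ (λ i → f (a + i)) (suc b)         ∎
  where open ≡-Reasoning

∑-pairs : ∀ f l → ∑ f (l + l) ≡ ∑ (λ j → f (j + j) + f (suc (j + j))) l
∑-pairs f zero    = refl
∑-pairs f (suc l) = begin
  ∑ f (suc l + suc l)                               ≡⟨ cong (λ n → ∑ f (suc n)) (+-suc l l) ⟩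
  ∑ f (l + l) + f (l + l) + f (suc (l + l))         ≡⟨ +-assoc (∑ f (l + l)) _ _ ⟩
  ∑ f (l + l) + (f (l + l) + f (suc (l + l)))       ≡⟨ cong (_+ (f (l + l) + f (suc (l + l)))) (∑-pairs f l) ⟩
  ∑ (λ j → f (j + j) + f (suc (j + j))) (suc l)     ∎
  where open ≡-Reasoning

∑-rotate : ∀ f m → f m ≡ f 0 → ∑ (λ i → f (suc i)) m ≡ ∑ f m
∑-rotate f m fm≡f0 = +-cancelʳ-≡ (f 0) _ _ (trans (shift m) (cong (∑ f m +_) fm≡f0))
  where
  shift : ∀ m → ∑ (λ i → f (suc i)) m + f 0 ≡ ∑ f m + f m
  shift zero    = refl
  shift (suc m) = begin
    ∑ (λ i → f (suc i)) m + f (suc m) + f 0   ≡⟨ +-assoc (∑ (λ i → f (suc i)) m) _ _ ⟩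
    ∑ (λ i → f (suc i)) m + (f (suc m) + f 0) ≡⟨ cong (∑ (λ i → f (suc i)) m +_) (+-comm (f (suc m)) (f 0)) ⟩
    ∑ (λ i → f (suc i)) m + (f 0 + f (suc m)) ≡⟨ +-assoc (∑ (λ i → f (suc i)) m) _ _ ⟨
    ∑ (λ i → f (suc i)) m + f 0 + f (suc m)   ≡⟨ cong (_+ f (suc m)) (shift m) ⟩
    ∑ f m + f m + f (suc m)                   ∎
    where open ≡-Reasoning

∑-head : ∀ f m → ∑ f (suc m) ≡ f 0 + ∑ (f ∘ suc) m
∑-head f zero    = +-comm 0 (f 0)
∑-head f (suc m) = trans (cong (_+ f (suc m)) (∑-head f m)) (+-assoc (f 0) _ _)

∑≡0⇒≡0 : ∀ f m → ∑ f m ≡ 0 → ∀ i → i < m → f i ≡ 0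
∑≡0⇒≡0 f (suc m) eq i i<1+m with m≤n⇒m<n∨m≡n (s≤s⁻¹ i<1+m)
... | inj₁ i<m  = ∑≡0⇒≡0 f m (m+n≡0⇒m≡0 _ eq) i i<m
... | inj₂ refl = m+n≡0⇒n≡0 (∑ f m) eq

∣-∑ : ∀ {d} f m → (∀ i → i < m → d ∣ f i) → d ∣ ∑ f m
∣-∑ {d} f zero _ = d ∣0
∣-∑ f (suc m) d∣f = ∣m∣n⇒∣m+n (∣-∑ f m (λ i i<m → d∣f i (m<n⇒m<1+n i<m))) (d∣f m (n<1+n m))


-- Colour changes along a sequence

changes : (ℕ → Bool) → ℕ → ℕ
changes g m = ∑ (λ i → δ (g i) (g (suc i))) m

δ≤changes : ∀ g k → δ (g 0) (g k) ≤ changes g k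
δ≤changes g zero    = ≤-reflexive (cong bit (xor-same (g 0)))
δ≤changes g (suc k) = ≤-trans (δ-triangle (g 0) (g k) (g (suc k))) (+-monoˡ-≤ _ (δ≤changes g k))

2≤changes : ∀ g {m i} → g m ≡ g 0 → i < m → g i ≢ g 0 → 2 ≤ changes g m
2≤changes g {m} {i} gm≡g0 i<m gi≢g0 = begin
  1 + 1                          ≤⟨ +-mono-≤ to-i from-i ⟩
  changes g i + changes g′ d     ≡⟨ cong (changes g i +_) (∑-cong d (λ j _ → cong (δ (g′ j) ∘ g) (+-suc i j))) ⟩
  changes g i + ∑ (λ j → δ (g (i + j)) (g (suc (i + j)))) d ≡⟨ ∑-split _ i d ⟨
  changes g (i + d)              ≡⟨ cong (changes g) i+d≡m ⟩
  changes g m                    ∎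
  where
  open ≤-Reasoning
  d : ℕ
  d = m ∸ i
  g′ : ℕ → Bool
  g′ j = g (i + j)
  i+d≡m : i + d ≡ m
  i+d≡m = m+[n∸m]≡n (<⇒≤ i<m)
  to-i : 1 ≤ changes g i
  to-i = subst (_≤ changes g i) (≢⇒δ≡1 (gi≢g0 ∘ sym)) (δ≤changes g i)
  from-i : 1 ≤ changes g′ d
  from-i = subst (_≤ changes g′ d)
    (trans (cong₂ δ (cong g (+-identityʳ i)) (trans (cong g i+d≡m) gm≡g0)) (≢⇒δ≡1 gi≢g0))
    (δ≤changes g′ d)

constant⊎witness : ∀ (g : ℕ → Bool) m → (∀ i → i < m → g i ≡ g 0) ⊎ ∃ λ i → i < m × g i ≢ g 0
constant⊎witness g m with anyUpTo? (λ i → ¬? (g i Bool.≟ g 0)) m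
... | yes witness = inj₂ witness
... | no  none    = inj₁ λ i i<m → decidable-stable (g i Bool.≟ g 0) (λ gi≢g0 → none (i , i<m , gi≢g0))

constant-upto-period : ∀ (g : ℕ → Bool) {m} → g m ≡ g 0 → (∀ j → j < m → g j ≡ g 0) → ∀ j → j ≤ m → g j ≡ g 0
constant-upto-period g gm≡g0 const j j≤m with m≤n⇒m<n∨m≡n j≤m
... | inj₁ j<m  = const j j<m
... | inj₂ refl = gm≡g0

module _ (g : ℕ → Bool) where

  changes+bit≡bit : ∀ k → (∀ i → i < k → g (suc i) ≡ true → g i ≡ true) → changes g k + bit (g k) ≡ bit (g 0)
  changes+bit≡bit zero    _     = refl
  changes+bit≡bit (suc k) anti = begin
    changes g k + δ (g k) (g (suc k)) + bit (g (suc k))   ≡⟨ +-assoc (changes g k) _ _ ⟩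
    changes g k + (δ (g k) (g (suc k)) + bit (g (suc k))) ≡⟨ cong (changes g k +_) (δ+bit≡bit (anti k (n<1+n k))) ⟩
    changes g k + bit (g k)                               ≡⟨ changes+bit≡bit k (λ i i<k → anti i (m<n⇒m<1+n i<k)) ⟩
    bit (g 0)                                             ∎
    where open ≡-Reasoning

  antitone⇒changes≤2 : ∀ k → (∀ i → i < k → g (suc i) ≡ true → g i ≡ true) → changes g (suc k) ≤ 2
  antitone⇒changes≤2 k anti = +-mono-≤ first-k (bit≤1 _)
    where
    first-k : changes g k ≤ 1
    first-k = ≤-trans (m≤m+n _ _) (≤-trans (≤-reflexive (changes+bit≡bit k anti)) (bit≤1 (g 0)))

block⇒antitone : ∀ {g : ℕ → Bool} {L M} → (∀ i → i < L → g i ≡ true) → (∀ i → L ≤ i → i < M → g i ≡ false) →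
                 ∀ {i j} → i ≤ j → j < M → g j ≡ true → g i ≡ true
block⇒antitone {L = L} low high {i} {j} i≤j j<M gj with i <? L
... | yes i<L = low i i<L
... | no  i≮L = contradiction (trans (sym gj) (high j (≤-trans (≮⇒≥ i≮L) i≤j) j<M)) λ ()

∀<-pairs : ∀ (P : ℕ → Set) l → (∀ j → j < l → P (j + j) × P (suc (j + j))) → ∀ i → i < l + l → P i
∀<-pairs P (suc l) both i i<2+2l with m≤n⇒m<n∨m≡n (s≤s⁻¹ (subst (i <_) (cong suc (+-suc l l)) i<2+2l))
... | inj₂ refl = proj₂ (both l (n<1+n l))
... | inj₁ i<1+2l with m≤n⇒m<n∨m≡n (s≤s⁻¹ i<1+2l)
...   | inj₂ refl = proj₁ (both l (n<1+n l))
...   | inj₁ i<2l = ∀<-pairs P l (λ j j<l → both j (m<n⇒m<1+n j<l)) i i<2l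


-- Colourings of P(2l, 2)

Periodic : ℕ → (ℕ → Bool) → Set
Periodic n g = ∀ i → g (i + n) ≡ g i

Balanced : ℕ → (ℕ → Bool) → (ℕ → Bool) → Set
Balanced n x y = ∑ (λ i → bit (x i) + bit (y i)) n ≡ n

spokes : (ℕ → Bool) → (ℕ → Bool) → ℕ → ℕ
spokes x y n = ∑ (λ i → δ (x i) (y i)) n

chords : ℕ → (ℕ → Bool) → ℕ → ℕ
chords k y n = ∑ (λ i → δ (y i) (y (i + k))) n

-- The odd edges among u_i u_{i+1}, u_i v_i and v_i v_{i+k}, when x colours the u's and y the v's.
cost : ℕ → (ℕ → Bool) → (ℕ → Bool) → ℕ → ℕ
cost k x y i = δ (x i) (x (suc i)) + δ (x i) (y i) + δ (y i) (y (i + k))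

∑-cost : ∀ k x y n → ∑ (cost k x y) n ≡ changes x n + spokes x y n + chords k y n
∑-cost k x y n = trans (∑-distrib-+ n) (cong (_+ chords k y n) (∑-distrib-+ n))

evens odds : (ℕ → Bool) → ℕ → Bool
evens y j = y (j + j)
odds  y j = y (suc (j + j))

chords-2 : ∀ y l → chords 2 y (l + l) ≡ changes (evens y) l + changes (odds y) l
chords-2 y l = trans (∑-pairs _ l) (trans (∑-cong l (λ j _ → cong₂ _+_
    (cong (δ (y (j + j)) ∘ y) (two-steps j)) (cong (δ (y (suc (j + j))) ∘ y ∘ suc) (two-steps j))))
  (∑-distrib-+ l))
  where
  two-steps : ∀ j → j + j + 2 ≡ suc j + suc j
  two-steps j = trans (+-comm (j + j) 2) (cong suc (sym (+-suc j j)))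

module _ {n : ℕ} (x y : ℕ → Bool) where

  spokes-comm : spokes x y n ≡ spokes y x n
  spokes-comm = ∑-cong n (λ i _ → δ-sym (x i) (y i))

  balanced-comm : Balanced n x y → Balanced n y x
  balanced-comm bal = trans (∑-cong n (λ i _ → +-comm (bit (y i)) (bit (x i)))) bal

  spokes≡0⇒≡ : spokes x y n ≡ 0 → ∀ i → i < n → x i ≡ y i
  spokes≡0⇒≡ S≡0 i i<n = δ≡0⇒≡ (∑≡0⇒≡0 _ n S≡0 i i<n)

  -- The odd vertices are the odd ends of the odd spokes plus both ends of each doubly odd spoke.
  2∣spokes : 2 ∣ n → Balanced n x y → 2 ∣ spokes x y n
  2∣spokes 2∣n bal = ∣m+n∣m⇒∣n (subst (2 ∣_) count 2∣n) (∣-∑ _ n (λ i _ → divides (bit (x i ∧ y i)) (*-comm 2 (bit (x i ∧ y i)))))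
    where
    count : n ≡ ∑ (λ i → 2 * bit (x i ∧ y i)) n + spokes x y n
    count = begin
      n                                                            ≡⟨ bal ⟨
      ∑ (λ i → bit (x i) + bit (y i)) n                            ≡⟨ ∑-cong n (λ i _ → δ+2bit∧≡bit+bit (x i) (y i)) ⟨
      ∑ (λ i → δ (x i) (y i) + 2 * bit (x i ∧ y i)) n              ≡⟨ ∑-distrib-+ n ⟩
      spokes x y n + ∑ (λ i → 2 * bit (x i ∧ y i)) n              ≡⟨ +-comm (spokes x y n) _ ⟩
      ∑ (λ i → 2 * bit (x i ∧ y i)) n + spokes x y n              ∎
      where open ≡-Reasoning

spokes-self : ∀ x m → spokes x x m ≡ 0
spokes-self x m = trans (∑-cong m (λ i _ → cong bit (xor-same (x i)))) (trans (∑-const 0 m) (*-zeroʳ m))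

balanced-complement : ∀ {n x y c} → Balanced n x y → (∀ i → i < n → x i ≡ c) → ∀ i → i < n → y i ≡ not c
balanced-complement {n} {x} {y} {true} bal x≡c i i<n = bit≡0⇒false (∑≡0⇒≡0 _ n no-odd-y i i<n)
  where
  no-odd-y : ∑ (bit ∘ y) n ≡ 0
  no-odd-y = +-cancelˡ-≡ n _ 0 (begin
    n + ∑ (bit ∘ y) n                   ≡⟨ cong (_+ ∑ (bit ∘ y) n) (∑-ones n) ⟨
    ∑ (λ _ → 1) n + ∑ (bit ∘ y) n       ≡⟨ ∑-distrib-+ n ⟨
    ∑ (λ i → 1 + bit (y i)) n           ≡⟨ ∑-cong n (λ i i<n → cong (λ b → bit b + bit (y i)) (x≡c i i<n)) ⟨
    ∑ (λ i → bit (x i) + bit (y i)) n   ≡⟨ bal ⟩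
    n                                   ≡⟨ +-identityʳ n ⟨
    n + 0                               ∎)
    where open ≡-Reasoning
balanced-complement {n} {x} {y} {false} bal x≡c i i<n = ≡false-not (bit≡0⇒false (∑≡0⇒≡0 _ n no-even-y i i<n))
  where
  ≡false-not : ∀ {b} → not b ≡ false → b ≡ true
  ≡false-not {true} _ = refl
  all-odd-y : ∑ (bit ∘ y) n ≡ n
  all-odd-y = trans (sym (∑-cong n (λ i i<n → cong (λ b → bit b + bit (y i)) (x≡c i i<n)))) bal
  no-even-y : ∑ (bit ∘ not ∘ y) n ≡ 0
  no-even-y = +-cancelʳ-≡ n _ 0 (begin
    ∑ (bit ∘ not ∘ y) n + n               ≡⟨ cong (∑ (bit ∘ not ∘ y) n +_) all-odd-y ⟨
    ∑ (bit ∘ not ∘ y) n + ∑ (bit ∘ y) n   ≡⟨ ∑-distrib-+ n ⟨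
    ∑ (λ i → bit (not (y i)) + bit (y i)) n ≡⟨ ∑-cong n (λ i _ → bit-not+bit (y i)) ⟩
    ∑ (λ _ → 1) n                         ≡⟨ ∑-ones n ⟩
    n                                     ∎)
    where open ≡-Reasoning

monochromatic⇒spokes≡n : ∀ {n x y c} → Balanced n x y → (∀ i → i < n → x i ≡ c) → spokes x y n ≡ n
monochromatic⇒spokes≡n {n} {x} {y} {c} bal x≡c =
  trans (∑-cong n (λ i i<n → trans (cong₂ δ (x≡c i i<n) (balanced-complement bal x≡c i i<n)) (≢⇒δ≡1 (not-¬ {c} refl))))
        (∑-ones n)

alternating⇒n≤changes+2spokes : ∀ {n x y} → Periodic n x → Periodic n y → (∀ i → i < n → y i ≢ y (suc i)) →
                                 n ≤ changes x n + (spokes x y n + spokes x y n)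
alternating⇒n≤changes+2spokes {n} {x} {y} x-per y-per alternating = begin
  n                                                    ≡⟨ ∑-ones n ⟨
  ∑ (λ _ → 1) n                                        ≤⟨ ∑-mono-≤ n detour ⟩
  ∑ (λ i → δ (x i) (x (suc i)) + (F i + F (suc i))) n   ≡⟨ ∑-distrib-+ n ⟩
  changes x n + ∑ (λ i → F i + F (suc i)) n            ≡⟨ cong (changes x n +_) (∑-distrib-+ n) ⟩
  changes x n + (spokes x y n + ∑ (F ∘ suc) n)         ≡⟨ cong (λ s → changes x n + (spokes x y n + s)) (∑-rotate F n (cong₂ δ (x-per 0) (y-per 0))) ⟩
  changes x n + (spokes x y n + spokes x y n)          ∎
  where
  open ≤-Reasoning
  F : ℕ → ℕ
  F i = δ (x i) (y i)
  detour : ∀ i → i < n → 1 ≤ δ (x i) (x (suc i)) + (F i + F (suc i))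
  detour i i<n = begin
    1                                                      ≡⟨ ≢⇒δ≡1 (alternating i i<n) ⟨
    δ (y i) (y (suc i))                                    ≤⟨ δ-triangle (y i) (x i) (y (suc i)) ⟩
    δ (y i) (x i) + δ (x i) (y (suc i))                    ≤⟨ +-monoʳ-≤ (δ (y i) (x i)) (δ-triangle (x i) (x (suc i)) (y (suc i))) ⟩
    δ (y i) (x i) + (δ (x i) (x (suc i)) + F (suc i))      ≡⟨ cong (_+ (δ (x i) (x (suc i)) + F (suc i))) (δ-sym (y i) (x i)) ⟩
    F i + (δ (x i) (x (suc i)) + F (suc i))                ≡⟨ +-assoc (F i) _ _ ⟨
    F i + δ (x i) (x (suc i)) + F (suc i)                  ≡⟨ cong (_+ F (suc i)) (+-comm (F i) _) ⟩
    δ (x i) (x (suc i)) + F i + F (suc i)                  ≡⟨ +-assoc (δ (x i) (x (suc i))) _ _ ⟩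
    δ (x i) (x (suc i)) + (F i + F (suc i))                ∎

2∣m+m : ∀ m → 2 ∣ m + m
2∣m+m m = divides m (trans (cong (m +_) (sym (+-identityʳ m))) (*-comm 2 m))

2*l≡l+l : ∀ l → 2 * l ≡ l + l
2*l≡l+l l = cong (l +_) (+-identityʳ l)

2∣⇒≢0⇒2≤ : ∀ {s} → 2 ∣ s → s ≢ 0 → 2 ≤ s
2∣⇒≢0⇒2≤ (divides zero    refl) s≢0 = contradiction refl s≢0
2∣⇒≢0⇒2≤ (divides (suc q) refl) _   = s≤s (s≤s z≤n)

6≤changes+spokes : ∀ {n X S} → 8 ≤ n → 2 ≤ X → 2 ∣ S → n ≤ X + (S + S) → 6 ≤ X + S
6≤changes+spokes {X = X} 8≤n 2≤X (divides zero refl) n≤ = ≤-trans (m≤n+m 6 2) (≤-trans 8≤n n≤)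
6≤changes+spokes {X = X} 8≤n 2≤X (divides 1 refl) n≤ =
  +-monoˡ-≤ 2 (+-cancelʳ-≤ 4 4 X (≤-trans 8≤n n≤))
6≤changes+spokes 8≤n 2≤X (divides (suc (suc q)) refl) n≤ = +-mono-≤ 2≤X (s≤s (s≤s (s≤s (s≤s z≤n))))

module _ {l : ℕ} (4≤l : 4 ≤ l) {x y : ℕ → Bool}
         (x-per : Periodic (l + l) x) (y-per : Periodic (l + l) y) (bal : Balanced (l + l) x y) where

  private
    e o : ℕ → Bool
    e = evens y
    o = odds y
    n X S E O : ℕ
    n = l + l
    X = changes x n
    S = spokes x y n
    E = changes e l
    O = changes o l

    8≤n : 8 ≤ n
    8≤n = +-mono-≤ 4≤l 4≤l

    2∣S : 2 ∣ S
    2∣S = 2∣spokes x y (2∣m+m l) bal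

    -- With no odd spoke the outer cycle repeats the inner colouring, so every inner vertex is counted twice.
    halves-balanced : S ≡ 0 → Balanced l e o
    halves-balanced S≡0 = *-cancelˡ-≡ _ _ 2 (begin
      2 * ∑ B l                                         ≡⟨ cong (∑ B l +_) (+-identityʳ (∑ B l)) ⟩
      ∑ B l + ∑ B l                                     ≡⟨ ∑-distrib-+ l ⟨
      ∑ (λ j → B j + B j) l                             ≡⟨ ∑-cong l (λ j _ → interchange (bit (e j)) (bit (o j)) _ _) ⟩
      ∑ (λ j → (bit (e j) + bit (e j)) + (bit (o j) + bit (o j))) l ≡⟨ ∑-pairs (λ i → bit (y i) + bit (y i)) l ⟨
      ∑ (λ i → bit (y i) + bit (y i)) n                 ≡⟨ ∑-cong n (λ i i<n → cong (λ b → bit b + bit (y i)) (spokes≡0⇒≡ x y S≡0 i i<n)) ⟨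
      ∑ (λ i → bit (x i) + bit (y i)) n                 ≡⟨ bal ⟩
      l + l                                             ≡⟨ 2*l≡l+l l ⟨
      2 * l                                             ∎)
      where
      open ≡-Reasoning
      B : ℕ → ℕ
      B j = bit (e j) + bit (o j)

    S≢0-if-odds-vary : (∀ j → j < l → e j ≡ e 0) → ∀ {j} → j < l → o j ≢ o 0 → S ≢ 0
    S≢0-if-odds-vary e-const {j} j<l oj≢o0 S≡0 =
      oj≢o0 (trans (complement j j<l) (sym (complement 0 (≤-trans (s≤s z≤n) j<l))))
      where
      complement : ∀ i → i < l → o i ≡ not (e 0)
      complement = balanced-complement {x = e} {y = o} (halves-balanced S≡0) e-const

    S≢0-if-evens-vary : (∀ j → j < l → o j ≡ o 0) → ∀ {j} → j < l → e j ≢ e 0 → S ≢ 0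
    S≢0-if-evens-vary o-const {j} j<l ej≢e0 S≡0 =
      ej≢e0 (trans (complement j j<l) (sym (complement 0 (≤-trans (s≤s z≤n) j<l))))
      where
      complement : ∀ i → i < l → e i ≡ not (o 0)
      complement = balanced-complement {x = o} {y = e} (balanced-comm e o (halves-balanced S≡0)) o-const

    y-alternates : (∀ j → j < l → e j ≡ e 0) → (∀ j → j < l → o j ≡ o 0) → e 0 ≢ o 0 →
                   ∀ i → i < n → y i ≢ y (suc i)
    y-alternates e-const o-const e0≢o0 = ∀<-pairs _ l λ j j<l →
        (λ eq → e0≢o0 (trans (sym (e-const j j<l)) (trans eq (o-const j j<l))))
      , (λ eq → e0≢o0 (trans (sym (e-closed (suc j) j<l)) (trans (cong y (cong suc (+-suc j j))) (trans (sym eq) (o-const j j<l)))))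
      where
      e-closed : ∀ j → j ≤ l → e j ≡ e 0
      e-closed = constant-upto-period e (y-per 0) e-const

    y-constant : (∀ j → j < l → e j ≡ e 0) → (∀ j → j < l → o j ≡ o 0) → e 0 ≡ o 0 → ∀ i → i < n → y i ≡ e 0
    y-constant e-const o-const e0≡o0 = ∀<-pairs _ l λ j j<l → e-const j j<l , trans (o-const j j<l) (sym e0≡o0)

  6≤∑cost : 6 ≤ ∑ (cost 2 x y) n
  6≤∑cost = subst (6 ≤_) (sym total) bound
    where
    total : ∑ (cost 2 x y) n ≡ X + S + (E + O)
    total = trans (∑-cost 2 x y n) (cong (X + S +_) (chords-2 y l))
    all-spokes : S ≡ n → 6 ≤ X + S + (E + O)
    all-spokes S≡n = ≤-trans (m≤n+m 6 2) (≤-trans 8≤n (≤-trans (≤-reflexive (sym S≡n)) (≤-trans (m≤n+m S X) (m≤m+n _ _))))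
    bound : 6 ≤ X + S + (E + O)
    bound with constant⊎witness x n
    ... | inj₁ x-const            = all-spokes (monochromatic⇒spokes≡n bal x-const)
    ... | inj₂ (i , i<n , xi≢x0) = varying-outer (2≤changes x (x-per 0) i<n xi≢x0)
      where
      varying-outer : 2 ≤ X → 6 ≤ X + S + (E + O)
      varying-outer 2≤X with constant⊎witness e l | constant⊎witness o l
      ... | inj₂ (j , j<l , ej≢e0) | inj₂ (k , k<l , ok≢o0) =
            +-mono-≤ (≤-trans 2≤X (m≤m+n X S)) (+-mono-≤ (2≤changes e (y-per 0) j<l ej≢e0) (2≤changes o (y-per 1) k<l ok≢o0))
      ... | inj₁ e-const | inj₂ (k , k<l , ok≢o0) =
            +-mono-≤ (+-mono-≤ 2≤X (2∣⇒≢0⇒2≤ 2∣S (S≢0-if-odds-vary e-const k<l ok≢o0)))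
                     (≤-trans (2≤changes o (y-per 1) k<l ok≢o0) (m≤n+m O E))
      ... | inj₂ (j , j<l , ej≢e0) | inj₁ o-const =
            +-mono-≤ (+-mono-≤ 2≤X (2∣⇒≢0⇒2≤ 2∣S (S≢0-if-evens-vary o-const j<l ej≢e0)))
                     (≤-trans (2≤changes e (y-per 0) j<l ej≢e0) (m≤m+n E O))
      ... | inj₁ e-const | inj₁ o-const with e 0 Bool.≟ o 0
      ...   | yes e0≡o0 = all-spokes (trans (spokes-comm {n} x y)
                            (monochromatic⇒spokes≡n (balanced-comm x y bal) (y-constant e-const o-const e0≡o0)))
      ...   | no  e0≢o0 = ≤-trans (6≤changes+spokes 8≤n 2≤X 2∣S
                            (alternating⇒n≤changes+2spokes x-per y-per (y-alternates e-const o-const e0≢o0)))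
                            (m≤m+n _ _)


-- From labellings to colourings

parity-+-even : ∀ {a} b → 2 ∣ a → parity (a + b) ≡ parity b
parity-+-even {.(q * 2)} b (divides q refl) = trans (cong (_% 2) (+-comm (q * 2) b)) ([m+kn]%n≡m%n b q 2)

differ≡δ : ∀ {p q} → p < 2 → q < 2 → (if p ≡ᵇ q then 0 else 1) ≡ δ (p ≡ᵇ 1) (q ≡ᵇ 1)
differ≡δ {0}           {0}           _ _ = refl
differ≡δ {0}           {1}           _ _ = refl
differ≡δ {1}           {0}           _ _ = refl
differ≡δ {1}           {1}           _ _ = refl
differ≡δ {suc (suc _)} {_}           (s≤s (s≤s ())) _
differ≡δ {_}           {suc (suc _)} _ (s≤s (s≤s ()))

oddLabel : ∀ {n} → (Vtx n ⤖ Fin (2 * n)) → Vtx n → Bool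
oddLabel f w = parity (label (Bijection.to f w)) ≡ᵇ 1

oddEdge≡δ : ∀ {n} (f : Vtx n ⤖ Fin (2 * n)) p q →
            oddEdge (Bijection.to f) (p , q) ≡ δ (oddLabel f p) (oddLabel f q)
oddEdge≡δ f p q = differ≡δ (m%n<n (label (Bijection.to f p)) 2) (m%n<n (label (Bijection.to f q)) 2)

sumᶠ≡∑ : ∀ {m} (F : Fin m → ℕ) (f : ℕ → ℕ) → (∀ i → F i ≡ f (toℕ i)) → Finite.sum F ≡ ∑ f m
sumᶠ≡∑ {zero}  F f _  = refl
sumᶠ≡∑ {suc m} F f eq = trans (cong₂ _+_ (eq 0F) (sumᶠ≡∑ {m} (F ∘ fsuc) (f ∘ suc) (eq ∘ fsuc))) (sym (∑-head f m))

sum-tabulate : ∀ {m} (F : Fin m → ℕ) → sum (tabulate F) ≡ Finite.sum F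
sum-tabulate {zero}  F = refl
sum-tabulate {suc m} F = cong (F 0F +_) (sum-tabulate (F ∘ fsuc))

sumᶠ-↑ : ∀ {m n} (F : Fin (m + n) → ℕ) → Finite.sum F ≡ Finite.sum {m} (F ∘ (_↑ˡ n)) + Finite.sum {n} (F ∘ (m ↑ʳ_))
sumᶠ-↑ {zero}  F = refl
sumᶠ-↑ {suc m} {n} F = trans (cong (F 0F +_) (sumᶠ-↑ {m} {n} (F ∘ fsuc))) (sym (+-assoc (F 0F) _ _))

sumᶠ-combine : ∀ {m n} (F : Fin (m * n) → ℕ) → Finite.sum F ≡ Finite.sum {m} (λ i → Finite.sum {n} (λ j → F (combine i j)))
sumᶠ-combine {zero}  F = refl
sumᶠ-combine {suc m} {n} F = begin
  Finite.sum F                                                ≡⟨ sumᶠ-↑ {n} {m * n} F ⟩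
  Finite.sum (F ∘ (_↑ˡ m * n)) + Finite.sum (F ∘ (n ↑ʳ_))     ≡⟨ cong (Finite.sum (F ∘ (_↑ˡ m * n)) +_) (sumᶠ-combine {m} {n} (F ∘ (n ↑ʳ_))) ⟩
  Finite.sum {n} (F ∘ (_↑ˡ m * n)) + Finite.sum {m} (λ i → Finite.sum {n} (λ j → F (n ↑ʳ combine i j))) ∎
  where open ≡-Reasoning

sum-concatMap : ∀ {A B : Set} (g : B → ℕ) (h : A → List B) xs →
                sum (map g (concatMap h xs)) ≡ sum (map (λ a → sum (map g (h a))) xs)
sum-concatMap g h []       = refl
sum-concatMap g h (a ∷ xs) = begin
  sum (map g (h a ++ concatMap h xs))                ≡⟨ cong sum (map-++ g (h a) (concatMap h xs)) ⟩
  sum (map g (h a) ++ map g (concatMap h xs))        ≡⟨ sum-++ (map g (h a)) _ ⟩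
  sum (map g (h a)) + sum (map g (concatMap h xs))   ≡⟨ cong (sum (map g (h a)) +_) (sum-concatMap g h xs) ⟩
  sum (map g (h a)) + sum (map (λ a → sum (map g (h a))) xs) ∎
  where open ≡-Reasoning

vtx↔ : ∀ {n} → Vtx n ↔ (Fin 2 × Fin n)
vtx↔ {n} = mk↔ₛ′ side unside side-unside unside-side
  where
  side : Vtx n → Fin 2 × Fin n
  side (u i) = 0F , i
  side (v i) = 1F , i
  unside : Fin 2 × Fin n → Vtx n
  unside (0F , i) = u i
  unside (1F , i) = v i
  side-unside : ∀ p → side (unside p) ≡ p
  side-unside (0F , i) = refl
  side-unside (1F , i) = refl
  unside-side : ∀ w → unside (side w) ≡ w
  unside-side (u i) = refl
  unside-side (v i) = refl

vertexIndex : ∀ {n} → Vtx n ↔ Fin (2 * n)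
vertexIndex = ↔-sym *↔× ↔-∘ vtx↔

toℕ-vertexIndex-u : ∀ {n} (i : Fin n) → toℕ (Inverse.to vertexIndex (u i)) ≡ toℕ i
toℕ-vertexIndex-u {n} i = toℕ-↑ˡ i (1 * n)

toℕ-vertexIndex-v : ∀ {n} (i : Fin n) → toℕ (Inverse.to vertexIndex (v i)) ≡ n + toℕ i
toℕ-vertexIndex-v {n} i = trans (toℕ-↑ʳ n (i ↑ˡ 0 * n)) (cong (n +_) (toℕ-↑ˡ i (0 * n)))

module _ {N : ℕ} .{{_ : NonZero N}} where

  toℕ-mod : ∀ m → toℕ (m mod N) ≡ m % N
  toℕ-mod m = toℕ-fromℕ< (m%n<n m N)

  mod-cong : ∀ a b → a % N ≡ b % N → a mod N ≡ b mod N
  mod-cong a b eq = toℕ-injective (trans (toℕ-mod a) (trans eq (sym (toℕ-mod b))))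

  toℕ-mod-inverse : ∀ (i : Fin N) → toℕ i mod N ≡ i
  toℕ-mod-inverse i = toℕ-injective (trans (toℕ-mod (toℕ i)) (m<n⇒m%n≡m (toℕ<n i)))

∑-odd-labels : ∀ m → Finite.sum {2 * m} (λ k → bit (parity (label k) ≡ᵇ 1)) ≡ m
∑-odd-labels m = begin
  Finite.sum {2 * m} (λ k → bit (parity (label k) ≡ᵇ 1))  ≡⟨ sumᶠ≡∑ {2 * m} _ H (λ _ → refl) ⟩
  ∑ H (2 * m)                                              ≡⟨ cong (λ n → ∑ H (m + n)) (+-identityʳ m) ⟩
  ∑ H (m + m)                                              ≡⟨ ∑-pairs H m ⟩
  ∑ (λ j → H (j + j) + H (suc (j + j))) m                  ≡⟨ ∑-cong m (λ j _ → cong₂ _+_ (even j) (odd j)) ⟩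
  ∑ (λ _ → 1) m                                            ≡⟨ ∑-ones m ⟩
  m                                                        ∎
  where
  open ≡-Reasoning
  H : ℕ → ℕ
  H i = bit (parity (i + 1) ≡ᵇ 1)
  even : ∀ j → H (j + j) ≡ 1
  even j = cong (λ p → bit (p ≡ᵇ 1)) (parity-+-even 1 (2∣m+m j))
  odd : ∀ j → H (suc (j + j)) ≡ 0
  odd j = cong (λ p → bit (p ≡ᵇ 1)) (trans (cong parity (sym (+-suc (j + j) 1))) (parity-+-even 2 (2∣m+m j)))

module _ {n : ℕ} (f : Vtx (suc n) ⤖ Fin (2 * suc n)) where

  outerOdd innerOdd : ℕ → Bool
  outerOdd i = oddLabel f (u (i mod suc n))
  innerOdd i = oddLabel f (v (i mod suc n))

  outerOdd-periodic : Periodic (suc n) outerOdd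
  outerOdd-periodic i = cong (oddLabel f ∘ u) (mod-cong (i + suc n) i ([m+n]%n≡m%n i (suc n)))

  innerOdd-periodic : Periodic (suc n) innerOdd
  innerOdd-periodic i = cong (oddLabel f ∘ v) (mod-cong (i + suc n) i ([m+n]%n≡m%n i (suc n)))

  oddCount≡∑cost : ∀ k → oddCount (suc n) k f ≡ ∑ (cost k outerOdd innerOdd) (suc n)
  oddCount≡∑cost k = begin
    oddCount (suc n) k f                                 ≡⟨ sum-concatMap (oddEdge to) edges (allFin (suc n)) ⟩
    sum (map edgeSum (allFin (suc n)))                   ≡⟨ cong sum (map-tabulate id edgeSum) ⟩
    sum (tabulate edgeSum)                               ≡⟨ sum-tabulate edgeSum ⟩
    Finite.sum edgeSum                                   ≡⟨ sumᶠ≡∑ edgeSum _ edgeSum≡cost ⟩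
    ∑ (cost k outerOdd innerOdd) (suc n)                 ∎
    where
    open ≡-Reasoning
    to : Vtx (suc n) → Fin (2 * suc n)
    to = Bijection.to f
    edges : Fin (suc n) → List (Vtx (suc n) × Vtx (suc n))
    edges i = (u i , u (i ⊕ 1)) ∷ (u i , v i) ∷ (v i , v (i ⊕ k)) ∷ []
    edgeSum : Fin (suc n) → ℕ
    edgeSum i = sum (map (oddEdge to) (edges i))
    edgeSum≡cost : ∀ i → edgeSum i ≡ cost k outerOdd innerOdd (toℕ i)
    edgeSum≡cost i = begin
      edgeSum i                                                  ≡⟨ cong₂ _+_ outer-edge (cong₂ _+_ spoke (cong (_+ 0) chord)) ⟩
      δ (x t) (x (suc t)) + (δ (x t) (y t) + (δ (y t) (y (t + k)) + 0)) ≡⟨ cong (λ s → δ (x t) (x (suc t)) + (δ (x t) (y t) + s)) (+-identityʳ _) ⟩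
      δ (x t) (x (suc t)) + (δ (x t) (y t) + δ (y t) (y (t + k)))       ≡⟨ +-assoc (δ (x t) (x (suc t))) _ _ ⟨
      cost k x y t                                               ∎
      where
      x y : ℕ → Bool
      x = outerOdd
      y = innerOdd
      t : ℕ
      t = toℕ i
      at-i : ∀ w → oddLabel f (w i) ≡ oddLabel f (w (t mod suc n))
      at-i w = cong (oddLabel f ∘ w) (sym (toℕ-mod-inverse i))
      outer-edge : oddEdge to (u i , u (i ⊕ 1)) ≡ δ (x t) (x (suc t))
      outer-edge = trans (oddEdge≡δ f _ _) (cong₂ δ (at-i u) (cong (oddLabel f ∘ u) (mod-cong (t + 1) (suc t) (cong (_% suc n) (+-comm t 1)))))
      spoke : oddEdge to (u i , v i) ≡ δ (x t) (y t)
      spoke = trans (oddEdge≡δ f _ _) (cong₂ δ (at-i u) (at-i v))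
      chord : oddEdge to (v i , v (i ⊕ k)) ≡ δ (y t) (y (t + k))
      chord = trans (oddEdge≡δ f _ _) (cong (λ c → δ c (y (t + k))) (at-i v))

  balanced : Balanced (suc n) outerOdd innerOdd
  balanced = sym (begin
    suc n                                                                   ≡⟨ ∑-odd-labels (suc n) ⟨
    Finite.sum h                                                            ≡⟨ Finite.sum-permute h π ⟩
    Finite.sum (h ∘ (π ⟨$⟩ʳ_))                                              ≡⟨ sumᶠ-combine {2} {suc n} (h ∘ (π ⟨$⟩ʳ_)) ⟩
    Finite.sum {2} (λ s → Finite.sum {suc n} (λ i → h (π ⟨$⟩ʳ combine s i)))
      ≡⟨ cong₂ (λ a b → a + (b + 0)) (Finite.sum-cong-≗ (side-sum 0F)) (Finite.sum-cong-≗ (side-sum 1F)) ⟩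
    Finite.sum (odd ∘ u) + (Finite.sum (odd ∘ v) + 0)                      ≡⟨ cong (Finite.sum (odd ∘ u) +_) (+-identityʳ _) ⟩
    Finite.sum (odd ∘ u) + Finite.sum (odd ∘ v)
      ≡⟨ cong₂ _+_ (sumᶠ≡∑ _ _ (λ i → cong (odd ∘ u) (sym (toℕ-mod-inverse i))))
                   (sumᶠ≡∑ _ _ (λ i → cong (odd ∘ v) (sym (toℕ-mod-inverse i)))) ⟩
    ∑ (bit ∘ outerOdd) (suc n) + ∑ (bit ∘ innerOdd) (suc n)                 ≡⟨ ∑-distrib-+ (suc n) ⟨
    ∑ (λ i → bit (outerOdd i) + bit (innerOdd i)) (suc n)                  ∎)
    where
    open ≡-Reasoning
    h : Fin (2 * suc n) → ℕ
    h k = bit (parity (label k) ≡ᵇ 1)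
    odd : Vtx (suc n) → ℕ
    odd w = bit (oddLabel f w)
    -- Listing the labels of f in the order of vertexIndex permutes them, which keeps the count of odd ones.
    π : Permutation′ (2 * suc n)
    π = ⤖⇒↔ f ↔-∘ ↔-sym vertexIndex
    side-sum : ∀ s i → h (π ⟨$⟩ʳ combine s i) ≡ odd (Inverse.from vtx↔ (s , i))
    side-sum s i = cong (odd ∘ Inverse.from vtx↔) (remQuot-combine s i)


6≤oddCount : ∀ {k} → 4 ≤ suc k → (f : Vtx (2 * suc k) ⤖ Fin (2 * (2 * suc k))) → 6 ≤ oddCount (2 * suc k) 2 f
6≤oddCount {k} 4≤l f = begin
  6                                                   ≤⟨ 6≤∑cost 4≤l (periodic (outerOdd-periodic f)) (periodic (innerOdd-periodic f)) bal ⟩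
  ∑ (cost 2 (outerOdd f) (innerOdd f)) (l + l)        ≡⟨ cong (∑ _) (2*l≡l+l l) ⟨
  ∑ (cost 2 (outerOdd f) (innerOdd f)) (2 * l)        ≡⟨ oddCount≡∑cost f 2 ⟨
  oddCount (2 * l) 2 f                                ∎
  where
  open ≤-Reasoning
  l : ℕ
  l = suc k
  periodic : ∀ {g} → Periodic (2 * l) g → Periodic (l + l) g
  periodic {g} = subst (λ n → Periodic n g) (2*l≡l+l l)
  bal : Balanced (l + l) (outerOdd f) (innerOdd f)
  bal = subst (λ n → Balanced n (outerOdd f) (innerOdd f)) (2*l≡l+l l) (balanced f)


-- An optimal labelling

cast↔ : ∀ {m n} → m ≡ n → Fin m ↔ Fin n
cast↔ eq = mk↔ₛ′ (cast eq) (cast (sym eq)) (cast-involutive eq (sym eq)) (cast-involutive (sym eq) eq)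

relabel : ∀ {n} → Fin n ↔ Fin n → Vtx n ↔ Vtx n
relabel σ = ↔-sym vtx↔ ↔-∘ ((↔-id (Fin 2) ×-↔ σ) ↔-∘ vtx↔)

module _ (L : ℕ) where

  -- i = h * L + r with h < 2 and r < L goes to 2 * r + h, so u_i and v_i get odd labels iff i < L.
  unshuffle : Fin (2 * L) ↔ Fin (2 * L)
  unshuffle = cast↔ (*-comm L 2) ↔-∘ (↔-sym *↔× ↔-∘ (×-comm (Fin 2) (Fin L) ↔-∘ *↔×))

  toℕ-unshuffle : ∀ h r → toℕ (Inverse.to unshuffle (combine h r)) ≡ 2 * toℕ r + toℕ h
  toℕ-unshuffle h r = trans (toℕ-cast (*-comm L 2) _)
    (trans (cong (toℕ ∘ uncurry combine ∘ swap) (remQuot-combine {2} {L} h r)) (toℕ-combine r h))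

  blocks : Vtx (2 * L) ⤖ Fin (2 * (2 * L))
  blocks = ↔⇒⤖ (vertexIndex ↔-∘ relabel unshuffle)

  oddLabel-blocks-v : ∀ j → oddLabel blocks (v j) ≡ oddLabel blocks (u j)
  oddLabel-blocks-v j = cong (_≡ᵇ 1) (begin
    parity (toℕ (Inverse.to vertexIndex (v t)) + 1)   ≡⟨ cong (λ m → parity (m + 1)) (toℕ-vertexIndex-v t) ⟩
    parity (2 * L + toℕ t + 1)                        ≡⟨ cong parity (+-assoc (2 * L) (toℕ t) 1) ⟩
    parity (2 * L + (toℕ t + 1))                      ≡⟨ parity-+-even (toℕ t + 1) (m∣m*n L) ⟩
    parity (toℕ t + 1)                                ≡⟨ cong (λ m → parity (m + 1)) (toℕ-vertexIndex-u t) ⟨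
    parity (toℕ (Inverse.to vertexIndex (u t)) + 1)   ∎)
    where
    open ≡-Reasoning
    t : Fin (2 * L)
    t = Inverse.to unshuffle j

  oddLabel-blocks-u : ∀ h r → oddLabel blocks (u (combine h r)) ≡ (parity (toℕ h + 1) ≡ᵇ 1)
  oddLabel-blocks-u h r = cong (_≡ᵇ 1) (begin
    parity (toℕ (Inverse.to vertexIndex (u t)) + 1)   ≡⟨ cong (λ m → parity (m + 1)) (toℕ-vertexIndex-u t) ⟩
    parity (toℕ t + 1)                                ≡⟨ cong (λ m → parity (m + 1)) (toℕ-unshuffle h r) ⟩
    parity (2 * toℕ r + toℕ h + 1)                    ≡⟨ cong parity (+-assoc (2 * toℕ r) (toℕ h) 1) ⟩
    parity (2 * toℕ r + (toℕ h + 1))                  ≡⟨ parity-+-even (toℕ h + 1) (m∣m*n (toℕ r)) ⟩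
    parity (toℕ h + 1)                                ∎)
    where
    open ≡-Reasoning
    t : Fin (2 * L)
    t = Inverse.to unshuffle (combine h r)

  oddLabel-blocks-low : ∀ j → toℕ j < L → oddLabel blocks (u j) ≡ true
  oddLabel-blocks-low j = subst (λ j → toℕ j < L → oddLabel blocks (u j) ≡ true) (combine-remQuot {2} L j)
                                (low (proj₁ (remQuot {2} L j)) (proj₂ (remQuot {2} L j)))
    where
    low : ∀ (h : Fin 2) (r : Fin L) → toℕ (combine h r) < L → oddLabel blocks (u (combine h r)) ≡ true
    low 0F r _   = oddLabel-blocks-u 0F r
    low 1F r j<L = contradiction j<L (≤⇒≯ (begin
      L                  ≤⟨ m≤m+n L (toℕ r) ⟩
      L + toℕ r          ≡⟨ cong (_+ toℕ r) (*-identityʳ L) ⟨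
      L * 1 + toℕ r      ≡⟨ toℕ-combine {2} 1F r ⟨
      toℕ (combine {2} 1F r) ∎))
      where open ≤-Reasoning

  oddLabel-blocks-high : ∀ j → L ≤ toℕ j → oddLabel blocks (u j) ≡ false
  oddLabel-blocks-high j = subst (λ j → L ≤ toℕ j → oddLabel blocks (u j) ≡ false) (combine-remQuot {2} L j)
                                 (high (proj₁ (remQuot {2} L j)) (proj₂ (remQuot {2} L j)))
    where
    high : ∀ (h : Fin 2) (r : Fin L) → L ≤ toℕ (combine h r) → oddLabel blocks (u (combine h r)) ≡ false
    high 1F r _   = oddLabel-blocks-u 1F r
    high 0F r L≤j = contradiction L≤j (<⇒≱ (begin-strict
      toℕ (combine {2} 0F r) ≡⟨ toℕ-combine {2} 0F r ⟩
      L * 0 + toℕ r      ≡⟨ cong (_+ toℕ r) (*-zeroʳ L) ⟩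
      toℕ r              <⟨ toℕ<n r ⟩
      L                  ∎))
      where open ≤-Reasoning

oddCount-blocks≤6 : ∀ k → oddCount (2 * suc k) 2 (blocks (suc k)) ≤ 6
oddCount-blocks≤6 k = begin
  oddCount (2 * L) 2 f                                              ≡⟨ oddCount≡∑cost f 2 ⟩
  ∑ (cost 2 x (innerOdd f)) (2 * L)                                 ≡⟨ ∑-cong (2 * L) (λ i _ → cong₂ (λ a b → δ (x i) (x (suc i)) + δ (x i) a + δ a b)
                                                                                           (inner≡outer i) (inner≡outer (i + 2))) ⟩
  ∑ (cost 2 x x) (2 * L)                                            ≡⟨ cong (∑ (cost 2 x x)) (2*l≡l+l L) ⟩
  ∑ (cost 2 x x) (L + L)                                            ≡⟨ ∑-cost 2 x x (L + L) ⟩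
  changes x (L + L) + spokes x x (L + L) + chords 2 x (L + L)       ≡⟨ cong₂ (λ s c → changes x (L + L) + s + c) (spokes-self x (L + L)) (chords-2 x L) ⟩
  changes x (L + L) + 0 + (changes (evens x) L + changes (odds x) L) ≤⟨ +-mono-≤ (+-monoˡ-≤ 0 outer≤2) (+-mono-≤ evens≤2 odds≤2) ⟩
  6                                                                 ∎
  where
  open ≤-Reasoning
  L : ℕ
  L = suc k
  f : Vtx (2 * L) ⤖ Fin (2 * (2 * L))
  f = blocks L
  x : ℕ → Bool
  x = outerOdd f
  inner≡outer : ∀ i → innerOdd f i ≡ x i
  inner≡outer i = oddLabel-blocks-v L (i mod (2 * L))
  toℕ-mod-< : ∀ {i} → i < L + L → toℕ (i mod (2 * L)) ≡ i
  toℕ-mod-< {i} i<2L = trans (toℕ-mod i) (m<n⇒m%n≡m (subst (i <_) (sym (2*l≡l+l L)) i<2L))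
  low : ∀ i → i < L → x i ≡ true
  low i i<L = oddLabel-blocks-low L _ (subst (_< L) (sym (toℕ-mod-< (≤-trans i<L (m≤m+n L L)))) i<L)
  high : ∀ i → L ≤ i → i < L + L → x i ≡ false
  high i L≤i i<2L = oddLabel-blocks-high L _ (subst (L ≤_) (sym (toℕ-mod-< i<2L)) L≤i)
  antitone : ∀ {i j} → i ≤ j → j < L + L → x j ≡ true → x i ≡ true
  antitone = block⇒antitone {x} low high
  outer≤2 : changes x (L + L) ≤ 2
  outer≤2 = antitone⇒changes≤2 x (k + L) (λ i i<k+L → antitone (n≤1+n i) (s≤s i<k+L))
  evens≤2 : changes (evens x) L ≤ 2
  evens≤2 = antitone⇒changes≤2 (evens x) k (λ j j<k → antitone (+-mono-≤ (n≤1+n j) (n≤1+n j)) (+-mono-< (s≤s j<k) (s≤s j<k)))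
  odds≤2 : changes (odds x) L ≤ 2
  odds≤2 = antitone⇒changes≤2 (odds x) k (λ j j<k → antitone (s≤s (+-mono-≤ (n≤1+n j) (n≤1+n j))) (+-mono-≤-< (s≤s j<k) (s≤s j<k)))

theorem4p9 : (l : ℕ) → 4 ≤ l → RnaNumber (2 * l) 2 6
theorem4p9 (suc k) 4≤l = (blocks (suc k) , ≤-antisym (oddCount-blocks≤6 k) (6≤oddCount 4≤l (blocks (suc k))))
                       , 6≤oddCount 4≤l
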